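{- Let $I$ be an answer set of $P$. For every explanation $G=\langle I,E,\lambda\rangle$ of $I$ under $P$ there exists some answer set $J$ of the program $x(P,I)$ where $f(\ell,a) \in J$ iff $\lambda(a)=\ell$ in $G$.
   Context: A labelled logic program $P$ over a finite set of atoms is a set of rules, each with a distinct label, of the form $\ell : p_1 \vee \dots \vee p_m \leftarrow q_1 \wedge \dots \wedge q_n \wedge \neg s_1 \wedge \dots \wedge \neg s_j \wedge \neg\neg t_1 \wedge \dots \wedge \neg\neg t_k$. For such a rule $r$: its label is $\ell$; its head atoms are $\{p_1,\dots,p_m\}$; its body is the whole antecedent; its positive body atoms are $\{q_1,\dots,q_n\}$. The reduct $P^I$ keeps, for each rule $r$ whose negative part $\neg s_1 \wedge \dots \wedge \neg\neg t_k$ is true in $I$, the labelled positive rule $\ell : p_1 \vee \dots \vee p_m \leftarrow q_1 \wedge \dots \wedge q_n$; $I$ is an answer set (stable model) of $P$ if $I$ is a minimal model of $P^I$. For a model $I$ of $P$, a rule $r$ supports atom $p$ under $I$ if $p$ is a head atom of $r$ and $I$ satisfies the body of $r$. An explanation of $I$ under $P$ is a labelled directed graph $G=\langle I,E,\lambda\rangle$ with vertex set $I$, edges $E \subseteq I\times I$, and $\lambda$ mapping each atom of $I$ to a rule label of $P$, such that (i) $\lambda$ is injective; (ii) for every $p \in I$, the rule $r$ with label $\lambda(p)$ supports $p$ under $I$ and its positive body atoms are exactly $\{q \mid (q,p)\in E\}$; (iii) $G$ is acyclic. The meta-program $x(P,I)$ (for an answer set $I$ of $P$) is a ground ASP program over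 atoms $f(\ell,p)$ ("rule $\ell$ is fired for $p$") and $f(a)$ ("$a$ is derived"), equivalent to the following rules: (a) choice rules $\{ f(\ell,p) \} \leftarrow f(q_1) \wedge \dots \wedge f(q_n)$ for each rule $r$ of $P$ with label $\ell$ and positive body atoms $q_1,\dots,q_n$ such that $I$ satisfies the body of $r$ and $p$ is a head atom of $r$ belonging to $I$; (b) constraints $\bot \leftarrow f(\ell,p_i) \wedge f(\ell,p_j)$ for each rule of $P$ with label $\ell$ and distinct head atoms $p_i \neq p_j$; (c) $f(a) \leftarrow f(\ell,a)$ for each $a \in I$ and label $\ell$; (d) constraints $\bot \leftarrow \text{not } f(a)$ for each $a \in I$; (e) constraints $\bot \leftarrow f(\ell,a) \wedge f(\ell',a)$ for each $a \in I$ and labels $\ell \neq \ell'$. -}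

module Defs where

open import Data.Bool using (Bool; true; false)
open import Data.Nat using (ℕ)
open import Data.Fin using (Fin)
open import Data.List using (List; []; _∷_; map)
open import Data.List.Membership.Propositional using (_∈_)
open import Data.List.Relation.Unary.All using (All)
open import Data.List.Relation.Unary.Any using (Any)
open import Data.Product using (Σ; _×_; ∃-syntax)
open import Function.Bundles using (_⇔_)
open import Relation.Binary.PropositionalEquality using (_≡_; _≢_)
open import Relation.Binary.Construct.Closure.Transitive using (TransClosure)
open import Relation.Nullary using (¬_)

-- Syntax: a rule  p1 ∨ … ∨ pm ← q1 ∧ … ∧ qn ∧ ¬s1 ∧ … ∧ ¬sj ∧ ¬¬t1 ∧ … ∧ ¬¬tk
-- over an atom type A.

record Rule (A : Set) : Set where
  constructor rule
  field
    head   : List A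
    pos    : List A
    neg    : List A
    negneg : List A
open Rule public

Interp : Set → Set
Interp A = A → Bool

_∈I_ : {A : Set} → A → Interp A → Set
a ∈I I = I a ≡ true

_⊆I_ : {A : Set} → Interp A → Interp A → Set
J ⊆I I = ∀ a → a ∈I J → a ∈I I

NegTrue : {A : Set} → Interp A → Rule A → Set
NegTrue I r = All (λ s → I s ≡ false) (neg r) × All (λ t → t ∈I I) (negneg r)

BodyTrue : {A : Set} → Interp A → Rule A → Set
BodyTrue I r = All (λ q → q ∈I I) (pos r) × NegTrue I r

PosSat : {A : Set} → Interp A → Rule A → Set
PosSat J r = All (λ q → q ∈I J) (pos r) → Any (λ p → p ∈I J) (head r)

-- A (ground) program is a family of rules indexed by a set R
-- (for labelled programs R is the set of labels).
-- J is a model of the reduct P^I.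
ReductModel : {R A : Set} → (R → Rule A) → Interp A → Interp A → Set
ReductModel {R} P I J = (i : R) → NegTrue I (P i) → PosSat J (P i)

AnswerSet : {R A : Set} → (R → Rule A) → Interp A → Set
AnswerSet P I =
  ReductModel P I I × (∀ J → J ⊆I I → ReductModel P I J → I ⊆I J)

-- Labelled programs over the finite atom set Fin n with labels Fin m:
-- the rule with label ℓ is P ℓ (so labels are distinct by construction).

LProgram : ℕ → ℕ → Set
LProgram m n = Fin m → Rule (Fin n)

Supports : {m n : ℕ} → LProgram m n → Interp (Fin n) → Fin m → Fin n → Set
Supports P I ℓ p = p ∈ head (P ℓ) × BodyTrue I (P ℓ)

-- Explanation G = ⟨I, E, λ⟩ of I under P.  λ is defined on the vertices
-- (atoms of I); E is a relation between vertices.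
record Explanation {m n : ℕ} (P : LProgram m n) (I : Interp (Fin n)) : Set₁ where
  field
    E       : Fin n → Fin n → Set
    E⊆I×I   : ∀ p q → E p q → p ∈I I × q ∈I I
    lab     : (p : Fin n) → p ∈I I → Fin m
    lab-inj : ∀ p q (hp : p ∈I I) (hq : q ∈I I) → lab p hp ≡ lab q hq → p ≡ q
    lab-supports : ∀ p (hp : p ∈I I) → Supports P I (lab p hp) p
    lab-pos      : ∀ p (hp : p ∈I I) q → (q ∈ pos (P (lab p hp)) ⇔ E q p)
    acyclic : ∀ p → ¬ TransClosure E p p

data MAtom (m n : ℕ) : Set where
  fired   : Fin m → Fin n → MAtom m n   -- f(ℓ, p)
  derived : Fin n → MAtom m n           -- f(a)

data XIx {m n : ℕ} (P : LProgram m n) (I : Interp (Fin n)) : Set where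
  choiceR : (ℓ : Fin m) (p : Fin n) → BodyTrue I (P ℓ) → p ∈ head (P ℓ) → p ∈I I → XIx P I
  oneHead : (ℓ : Fin m) (pi pj : Fin n) → pi ∈ head (P ℓ) → pj ∈ head (P ℓ) → pi ≢ pj → XIx P I
  deriveR : (a : Fin n) (ℓ : Fin m) → a ∈I I → XIx P I
  needR   : (a : Fin n) → a ∈I I → XIx P I
  oneRule : (a : Fin n) (ℓ ℓ' : Fin m) → a ∈I I → ℓ ≢ ℓ' → XIx P I

-- The rules, in the language above.  The choice rule {h} ← B is
-- rendered by its standard equivalent  h ← B ∧ ¬¬h ; a constraint ⊥ ← B
-- is a rule with empty head; "not" is ¬.
xRule : {m n : ℕ} {P : LProgram m n} {I : Interp (Fin n)} → XIx P I → Rule (MAtom m n)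
xRule {P = P} (choiceR ℓ p _ _ _) =
  rule (fired ℓ p ∷ []) (map derived (pos (P ℓ))) [] (fired ℓ p ∷ [])
xRule (oneHead ℓ pi pj _ _ _) = rule [] (fired ℓ pi ∷ fired ℓ pj ∷ []) [] []
xRule (deriveR a ℓ _)         = rule (derived a ∷ []) (fired ℓ a ∷ []) [] []
xRule (needR a _)             = rule [] [] (derived a ∷ []) []
xRule (oneRule a ℓ ℓ' _ _)    = rule [] (fired ℓ a ∷ fired ℓ' a ∷ []) [] []

xProg : {m n : ℕ} (P : LProgram m n) (I : Interp (Fin n)) → XIx P I → Rule (MAtom m n)
xProg P I = xRule {P = P} {I = I}

-- An explanation labels each atom a ∈ I with the rule λ(a) that fires for it, so the
-- intended answer set J of x(P,I) contains f(λ(a),a) and f(a) for every a ∈ I.  J is a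
-- model of its own reduct because λ is injective and a function.  It is minimal because
-- a finite acyclic graph is well founded: in any model K of the reduct, f(a) follows by
-- well-founded induction along E, the choice rule for λ(a) needing exactly f(q) for the
-- E-predecessors q of a.
module Submission where

open import Defs
open import Data.Nat using (ℕ; zero; suc; _+_; s<s; z<s)
open import Data.Nat.Properties using (n<1+n; +-suc; +-identityʳ)
open import Data.Fin using (Fin; zero; suc; _<_)
import Data.Fin as Fin
open import Data.Fin.Properties using (pigeonhole)
open import Data.Bool using (Bool; true)
import Data.Bool as Bool
open import Data.Product using (Σ-syntax; _×_; ∃-syntax; _,_; proj₁; proj₂)
open import Data.Empty using (⊥-elim)
open import Data.List.Relation.Unary.All using (All; []; _∷_)
import Data.List.Relation.Unary.All as All
open import Data.List.Relation.Unary.All.Properties using (map⁺)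
open import Data.List.Relation.Unary.Any using (here)
open import Data.List.Relation.Unary.Any.Properties using (singleton⁻)
open import Data.List.Membership.Propositional using (_∈_)
open import Function using (_∘_)
open import Function.Bundles using (_⇔_; mk⇔; Equivalence)
open import Induction.WellFounded using (WellFounded; Acc; acc)
open import Level using (Level)
open import Relation.Binary.Core using (Rel)
open import Relation.Binary.PropositionalEquality
  using (_≡_; refl; sym; trans; cong; subst)
open import Relation.Binary.Construct.Closure.Transitive using (TransClosure; [_]; _∷_)
open import Relation.Nullary using (¬_; Dec; yes; no; does)
open import Axiom.UniquenessOfIdentityProofs using (module Decidable⇒UIP)

≡true-irrelevant : {b : Bool} (h h′ : b ≡ true) → h ≡ h′
≡true-irrelevant = Decidable⇒UIP.≡-irrelevant Bool._≟_

does≡true⇔ : {A : Set} (a? : Dec A) → does a? ≡ true ⇔ A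
does≡true⇔ (yes a) = mk⇔ (λ _ → a) (λ _ → refl)
does≡true⇔ (no ¬a) = mk⇔ (λ ()) (⊥-elim ∘ ¬a)

module AcyclicFinite {n : ℕ} {ℓ : Level} (E : Rel (Fin n) ℓ) where

  data Walk : ℕ → Fin n → Set ℓ where
    nil  : ∀ {a} → Walk zero a
    step : ∀ {k a b} → E a b → Walk k b → Walk (suc k) a

  vertex : ∀ {k a} → Walk k a → Fin (suc k) → Fin n
  vertex {a = a} _ zero     = a
  vertex (step _ w) (suc i) = vertex w i

  start-reaches-vertex : ∀ {k a} (w : Walk k a) (j : Fin k) → TransClosure E a (vertex w (suc j))
  start-reaches-vertex (step e _) zero    = [ e ]
  start-reaches-vertex (step e w) (suc j) = e ∷ start-reaches-vertex w j

  vertex-reaches : ∀ {k a} (w : Walk k a) {i j : Fin (suc k)} → i < j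
                 → TransClosure E (vertex w i) (vertex w j)
  vertex-reaches w          {zero}  {suc j} z<s       = start-reaches-vertex w j
  vertex-reaches (step _ w) {suc i} {suc j} (s<s i<j) = vertex-reaches w i<j

  module _ (acyclic : ∀ p → ¬ TransClosure E p p) where

    -- A walk with n + 1 vertices repeats one of them.
    no-walk-of-length-n : ∀ {a} → ¬ Walk n a
    no-walk-of-length-n w with i , j , i<j , vᵢ≡vⱼ ← pigeonhole (n<1+n n) (vertex w) =
      acyclic _ (subst (TransClosure E (vertex w i)) (sym vᵢ≡vⱼ) (vertex-reaches w i<j))

    -- d bounds the number of further steps before a walk would reach length n.
    acc-from-walk : ∀ d {k a} → d + k ≡ n → Walk k a → Acc E a
    acc-from-walk zero    refl w = ⊥-elim (no-walk-of-length-n w)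
    acc-from-walk (suc d) {k} d+1+k≡n w =
      acc λ e → acc-from-walk d (trans (+-suc d k) d+1+k≡n) (step e w)

    acyclic⇒wellFounded : WellFounded E
    acyclic⇒wellFounded a = acc-from-walk n (+-identityʳ n) nil

module IntendedAnswerSet {m n : ℕ} (P : LProgram m n) (I : Interp (Fin n)) (G : Explanation P I) where
  open Explanation G

  Fires : Fin m → Fin n → Set
  Fires ℓ a = Σ[ h ∈ a ∈I I ] lab a h ≡ ℓ

  lab-irrelevant : ∀ {a} (h h′ : a ∈I I) → lab a h ≡ lab a h′
  lab-irrelevant {a} h h′ = cong (lab a) (≡true-irrelevant h h′)

  fires? : ∀ ℓ a → Dec (Fires ℓ a)
  fires? ℓ a with I a Bool.≟ true
  ... | no a∉I = no (a∉I ∘ proj₁)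
  ... | yes h with lab a h Fin.≟ ℓ
  ...   | yes λa≡ℓ = yes (h , λa≡ℓ)
  ...   | no  λa≢ℓ = no λ (h′ , λa≡ℓ) → λa≢ℓ (trans (lab-irrelevant h h′) λa≡ℓ)

  J : Interp (MAtom m n)
  J (fired ℓ a) = does (fires? ℓ a)
  J (derived a) = I a

  fired∈J⇔ : ∀ ℓ a → fired ℓ a ∈I J ⇔ Fires ℓ a
  fired∈J⇔ ℓ a = does≡true⇔ (fires? ℓ a)

  fired∈J⇒Fires : ∀ {ℓ a} → fired ℓ a ∈I J → Fires ℓ a
  fired∈J⇒Fires = Equivalence.to (fired∈J⇔ _ _)

  fires-injective : ∀ {ℓ a b} → Fires ℓ a → Fires ℓ b → a ≡ b
  fires-injective (h , refl) (h′ , λb≡λa) = lab-inj _ _ h h′ (sym λb≡λa)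

  fires-functional : ∀ {ℓ ℓ′ a} → Fires ℓ a → Fires ℓ′ a → ℓ ≡ ℓ′
  fires-functional (h , refl) (h′ , refl) = lab-irrelevant h h′

  J-model : ReductModel (xProg P I) J J
  J-model (choiceR _ _ _ _ _) (_ , (f∈J ∷ [])) _ = here f∈J
  J-model (oneHead ℓ _ _ _ _ pᵢ≢pⱼ) _ (fᵢ∈J ∷ fⱼ∈J ∷ []) =
    ⊥-elim (pᵢ≢pⱼ (fires-injective (fired∈J⇒Fires fᵢ∈J) (fired∈J⇒Fires fⱼ∈J)))
  J-model (deriveR _ _ a∈I) _ _ = here a∈I
  J-model (needR _ a∈I) ((fa∉J ∷ []) , _) _ with () ← trans (sym a∈I) fa∉J
  J-model (oneRule _ _ _ _ ℓ≢ℓ′) _ (f∈J ∷ f′∈J ∷ []) =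
    ⊥-elim (ℓ≢ℓ′ (fires-functional (fired∈J⇒Fires f∈J) (fired∈J⇒Fires f′∈J)))

  pos⇒E : ∀ {a} (h : a ∈I I) {q} → q ∈ pos (P (lab a h)) → E q a
  pos⇒E h = Equivalence.to (lab-pos _ h _)

  pos⊆I : ∀ {a} (h : a ∈I I) {q} → q ∈ pos (P (lab a h)) → q ∈I I
  pos⊆I h q∈pos = proj₁ (E⊆I×I _ _ (pos⇒E h q∈pos))

  module _ (K : Interp (MAtom m n)) (K-model : ReductModel (xProg P I) J K) where

    fired∈K : ∀ a (h : a ∈I I) → All (λ q → derived q ∈I K) (pos (P (lab a h)))
            → fired (lab a h) a ∈I K
    fired∈K a h pos∈K with head∋a , body ← lab-supports a h =
      singleton⁻ (K-model (choiceR _ a body head∋a h) ([] , (fλa∈J ∷ [])) (map⁺ pos∈K))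
      where
        fλa∈J : fired (lab a h) a ∈I J
        fλa∈J = Equivalence.from (fired∈J⇔ _ a) (h , refl)

    derived∈K-acc : ∀ a → Acc E a → a ∈I I → derived a ∈I K
    derived∈K-acc a (acc rs) h =
      singleton⁻ (K-model (deriveR a _ h) ([] , []) (fired∈K a h pos∈K ∷ []))
      where
        pos∈K : All (λ q → derived q ∈I K) (pos (P (lab a h)))
        pos∈K = All.tabulate λ q∈pos → derived∈K-acc _ (rs (pos⇒E h q∈pos)) (pos⊆I h q∈pos)

    derived∈K : ∀ a → a ∈I I → derived a ∈I K
    derived∈K a = derived∈K-acc a (AcyclicFinite.acyclic⇒wellFounded E acyclic a)

    J⊆K : J ⊆I K
    J⊆K (derived a) a∈I = derived∈K a a∈I
    J⊆K (fired ℓ a) f∈J with h , refl ← fired∈J⇒Fires f∈J =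
      fired∈K a h (All.tabulate λ q∈pos → derived∈K _ (pos⊆I h q∈pos))

  J-answerSet : AnswerSet (xProg P I) J
  J-answerSet = J-model , λ K _ K-model → J⊆K K K-model

theorem5 : {m n : ℕ} (P : LProgram m n) (I : Interp (Fin n))
    → AnswerSet P I
    → (G : Explanation P I)
    → ∃[ J ] (AnswerSet (xProg P I) J
        × (∀ (ℓ : Fin m) (a : Fin n)
             → (J (fired ℓ a) ≡ true ⇔ (Σ[ h ∈ I a ≡ true ] Explanation.lab G a h ≡ ℓ))))
theorem5 P I _ G = J , J-answerSet , fired∈J⇔
  where open IntendedAnswerSet P I G
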